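{- There exist reactive LPTSes $R_1$ and $R_2$ such that $R_1\not\preceq R_2$ and there is no fully-probabilistic LPTS $C$ with $C\preceq R_1$ and $C\not\preceq R_2$.
   Context: For a set $S$, $\mathrm{Dist}(S)$ is the set of discrete probability distributions on $S$ (rational probabilities). An LPTS is a tuple $\langle S,s^0,\alpha,\tau\rangle$ with finite state set $S$, start state $s^0$, finite action set $\alpha$ and finite transition relation $\tau\subseteq S\times\alpha\times\mathrm{Dist}(S)$; write $s\xrightarrow{a}\mu$. An LPTS is reactive if each state has at most one transition on each action, and fully-probabilistic if each state has at most one transition in total. For LPTSes $L_i=\langle S_i,s^0_i,\alpha_i,\tau_i\rangle$ and $R\subseteq S_1\times S_2$, $\mu_1\sqsubseteq_R\mu_2$ iff there is $w:S_1\times S_2\to\mathbb{Q}\cap[0,1]$ with $\mu_1(s_1)=\sum_{s_2}w(s_1,s_2)$, $\mu_2(s_2)=\sum_{s_1}w(s_1,s_2)$, and $w(s_1,s_2)>0\Rightarrow s_1Rs_2$. $R$ is a strong simulation iff whenever $s_1Rs_2$ and $s_1\xrightarrow{a}\mu_1$ there is $s_2\xrightarrow{a}\mu_2$ with $\mu_1\sqsubseteq_R\mu_2$; $L_1\preceq L_2$ iff some strong simulation contains $(s^0_1,s^0_2)$. -}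

module Defs where

open import Level using (0ℓ)
open import Data.Nat using (ℕ; zero; suc)
open import Data.Fin using (Fin) renaming (zero to fz; suc to fs)
open import Data.Rational using (ℚ; 0ℚ; 1ℚ; _+_; _≤_; _<_)
open import Data.List using (List)
open import Data.List.Membership.Propositional using (_∈_)
open import Data.Product using (Σ; Σ-syntax; _×_; _,_)
open import Relation.Binary.PropositionalEquality using (_≡_)
open import Relation.Nullary using (¬_)

-- Actions are drawn from a fixed countable universe (ℕ), so that different
-- LPTSes can share action names.
Action : Set
Action = ℕ

sumFin : (n : ℕ) → (Fin n → ℚ) → ℚ
sumFin zero    f = 0ℚ
sumFin (suc n) f = f fz + sumFin n (λ i → f (fs i))

record Dist (n : ℕ) : Set where
  field
    prob    : Fin n → ℚ
    nonneg  : ∀ i → 0ℚ ≤ prob i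
    sumsOne : sumFin n prob ≡ 1ℚ
open Dist public

record LPTS : Set where
  field
    nS      : ℕ
    start   : Fin nS
    acts    : List Action
    trans   : List (Fin nS × Action × Dist nS)
    transOK : ∀ s a μ → (s , a , μ) ∈ trans → a ∈ acts
open LPTS public

Step : (L : LPTS) → Fin (nS L) → Action → Dist (nS L) → Set
Step L s a μ = (s , a , μ) ∈ trans L

SameDist : ∀ {n} → Dist n → Dist n → Set
SameDist μ ν = ∀ i → prob μ i ≡ prob ν i

Reactive : LPTS → Set
Reactive L = ∀ s a μ ν → Step L s a μ → Step L s a ν → SameDist μ ν

FullyProbabilistic : LPTS → Set
FullyProbabilistic L =
  ∀ s a b μ ν → Step L s a μ → Step L s b ν → (a ≡ b) × SameDist μ ν

Lift : ∀ {n₁ n₂} → (Fin n₁ → Fin n₂ → Set) → Dist n₁ → Dist n₂ → Set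
Lift {n₁} {n₂} R μ₁ μ₂ =
  Σ[ w ∈ (Fin n₁ → Fin n₂ → ℚ) ]
    (∀ s₁ s₂ → 0ℚ ≤ w s₁ s₂) ×
    (∀ s₁ s₂ → w s₁ s₂ ≤ 1ℚ) ×
    (∀ s₁ → prob μ₁ s₁ ≡ sumFin n₂ (λ s₂ → w s₁ s₂)) ×
    (∀ s₂ → prob μ₂ s₂ ≡ sumFin n₁ (λ s₁ → w s₁ s₂)) ×
    (∀ s₁ s₂ → 0ℚ < w s₁ s₂ → R s₁ s₂)

IsStrongSimulation : (L₁ L₂ : LPTS) → (Fin (nS L₁) → Fin (nS L₂) → Set) → Set
IsStrongSimulation L₁ L₂ R =
  ∀ s₁ s₂ a μ₁ → R s₁ s₂ → Step L₁ s₁ a μ₁ →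
    Σ[ μ₂ ∈ Dist (nS L₂) ] (Step L₂ s₂ a μ₂ × Lift R μ₁ μ₂)

_≼_ : LPTS → LPTS → Set₁
L₁ ≼ L₂ = Σ[ R ∈ (Fin (nS L₁) → Fin (nS L₂) → Set) ]
  (IsStrongSimulation L₁ L₂ R × R (start L₁) (start L₂))

-- `joined` and `separated` both start with s₀ −0→ ½s₁ + ½s₂ and end in the deadlock
-- s₃. In `joined`, s₁ offers both actions 1 and 2; in `separated`, s₁ offers 1 and s₂
-- offers 2. No state of `separated` offers both, so none can simulate s₁ of `joined`;
-- but no state of a fully probabilistic C offers both either. If C ≼ joined, a step
-- of C matched with ½s₁ + ½s₂ puts its mass on states related to s₁ or s₂. Those
-- related to s₂ are deadlocked, so every state offering 1 or 2 lies in the s₁-column,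
-- and together they weigh at most ½. The idle states thus carry at least ½, enough to
-- top up both columns of `separated` to ½ each.
module Submission where

open import Algebra.Bundles using (Ring)
import Algebra.Properties.Semiring.Sum as SemiringSum
open import Data.Empty using (⊥-elim)
open import Data.Fin using (Fin; toℕ) renaming (zero to fz; suc to fs)
import Data.Fin as Fin
open import Data.Fin.Patterns using (0F; 1F; 2F; 3F)
open import Data.List using (List; []; _∷_; map)
open import Data.List.Membership.Propositional using (find; lose)
open import Data.List.Membership.Propositional.Properties using (∈-map⁺)
open import Data.List.Relation.Unary.Any using (Any; here; there; any?)
open import Data.Nat using (zero; suc)
import Data.Nat as ℕ
open import Data.Product using (Σ-syntax; ∃-syntax; _×_; _,_; proj₁; proj₂)
open import Data.Rational
  using (ℚ; 0ℚ; 1ℚ; ½; _+_; _*_; -_; _-_; _÷_; 1/_; _≤_; _<_; Positive; NonZero; positive; nonNegative)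
open import Data.Rational.Properties
open import Data.Rational.Solver using (module +-*-Solver)
open import Data.Sum using (_⊎_; inj₁; inj₂)
open import Function using (_∘_)
open import Relation.Binary.PropositionalEquality
open import Relation.Nullary using (¬_; Dec; yes; no)
open import Relation.Nullary.Decidable using (map′; _×-dec_)

open import Defs hiding (trans)

open +-*-Solver
open SemiringSum (Ring.semiring +-*-ring)
  using (sum; sum-cong-≗; ∑-distrib-+; *-distribʳ-sum; sum-replicate-zero)

sumFin≡sum : ∀ n (f : Fin n → ℚ) → sumFin n f ≡ sum f
sumFin≡sum zero    f = refl
sumFin≡sum (suc n) f = cong (f fz +_) (sumFin≡sum n (f ∘ fs))

sumFin-cong : ∀ n {f g : Fin n → ℚ} → (∀ i → f i ≡ g i) → sumFin n f ≡ sumFin n g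
sumFin-cong n {f} {g} f≗g = begin
  sumFin n f  ≡⟨ sumFin≡sum n f ⟩
  sum f       ≡⟨ sum-cong-≗ f≗g ⟩
  sum g       ≡⟨ sumFin≡sum n g ⟨
  sumFin n g  ∎
  where open ≡-Reasoning

sumFin-+ : ∀ n (f g : Fin n → ℚ) → sumFin n (λ i → f i + g i) ≡ sumFin n f + sumFin n g
sumFin-+ n f g = begin
  sumFin n (λ i → f i + g i)  ≡⟨ sumFin≡sum n _ ⟩
  sum (λ i → f i + g i)       ≡⟨ ∑-distrib-+ f g ⟩
  sum f + sum g               ≡⟨ cong₂ _+_ (sumFin≡sum n f) (sumFin≡sum n g) ⟨
  sumFin n f + sumFin n g     ∎
  where open ≡-Reasoning

sumFin-*ʳ : ∀ n (f : Fin n → ℚ) k → sumFin n (λ i → f i * k) ≡ sumFin n f * k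
sumFin-*ʳ n f k = begin
  sumFin n (λ i → f i * k)  ≡⟨ sumFin≡sum n _ ⟩
  sum (λ i → f i * k)       ≡⟨ *-distribʳ-sum k f ⟨
  sum f * k                 ≡⟨ cong (_* k) (sumFin≡sum n f) ⟨
  sumFin n f * k            ∎
  where open ≡-Reasoning

sumFin-zero : ∀ n → sumFin n (λ _ → 0ℚ) ≡ 0ℚ
sumFin-zero n = trans (sumFin≡sum n _) (sum-replicate-zero n)

sumFin-mono : ∀ n {f g : Fin n → ℚ} → (∀ i → f i ≤ g i) → sumFin n f ≤ sumFin n g
sumFin-mono zero    f≤g = ≤-refl
sumFin-mono (suc n) f≤g = +-mono-≤ (f≤g fz) (sumFin-mono n (f≤g ∘ fs))

sumFin-nonneg : ∀ n {f : Fin n → ℚ} → (∀ i → 0ℚ ≤ f i) → 0ℚ ≤ sumFin n f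
sumFin-nonneg n {f} f≥0 = subst (_≤ sumFin n f) (sumFin-zero n) (sumFin-mono n f≥0)

≤-sumFin : ∀ n {f : Fin n → ℚ} → (∀ i → 0ℚ ≤ f i) → ∀ i → f i ≤ sumFin n f
≤-sumFin (suc n) {f} f≥0 fz = subst (_≤ sumFin (suc n) f) (+-identityʳ (f fz))
  (+-mono-≤ (≤-refl {f fz}) (sumFin-nonneg n (f≥0 ∘ fs)))
≤-sumFin (suc n) {f} f≥0 (fs i) = subst (_≤ sumFin (suc n) f) (+-identityˡ (f (fs i)))
  (+-mono-≤ (f≥0 fz) (≤-sumFin n (f≥0 ∘ fs) i))

sumFin-pos : ∀ n (f : Fin n → ℚ) → 0ℚ < sumFin n f → ∃[ i ] 0ℚ < f i
sumFin-pos zero    f 0<0 = ⊥-elim (<-irrefl refl 0<0)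
sumFin-pos (suc n) f 0<Σ with 0ℚ <? f fz | 0ℚ <? sumFin n (f ∘ fs)
... | yes 0<f₀ | _        = fz , 0<f₀
... | no _     | yes 0<Σ′ = let i , 0<fᵢ = sumFin-pos n (f ∘ fs) 0<Σ′ in fs i , 0<fᵢ
... | no f₀≯0  | no Σ′≯0  =
  ⊥-elim (<-irrefl refl (<-≤-trans 0<Σ (+-mono-≤ (≮⇒≥ f₀≯0) (≮⇒≥ Σ′≯0))))

p≤q⇒0≤q-p : ∀ {p q} → p ≤ q → 0ℚ ≤ q - p
p≤q⇒0≤q-p {p} {q} p≤q = subst (_≤ q - p) (+-inverseʳ p) (+-monoˡ-≤ (- p) p≤q)

p<q⇒0<q-p : ∀ {p q} → p < q → 0ℚ < q - p
p<q⇒0<q-p {p} {q} p<q = subst (_< q - p) (+-inverseʳ p) (+-monoˡ-< (- p) p<q)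

p≤p+q : ∀ {p q} → 0ℚ ≤ q → p ≤ p + q
p≤p+q {p} {q} 0≤q = subst (_≤ p + q) (+-identityʳ p) (+-monoʳ-≤ p 0≤q)

q≤p+q : ∀ {p q} → 0ℚ ≤ p → q ≤ p + q
q≤p+q {p} {q} 0≤p = subst (_≤ p + q) (+-identityˡ q) (+-monoˡ-≤ q 0≤p)

*-nonneg : ∀ {p q} → 0ℚ ≤ p → 0ℚ ≤ q → 0ℚ ≤ p * q
*-nonneg {p} {q} 0≤p 0≤q =
  nonNegative⁻¹ (p * q) {{nonNeg*nonNeg⇒nonNeg p {{nonNegative 0≤p}} q {{nonNegative 0≤q}}}}

data Destination : Set where
  left right free : Destination

portion : Destination → Destination → ℚ → ℚ
portion left  left  x = x
portion right right x = x
portion free  free  x = x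
portion _     _     _ = 0ℚ

portion-split : ∀ d x → x ≡ portion left d x + portion right d x + portion free d x
portion-split left  x = solve 1 (λ x → x := x :+ con 0ℚ :+ con 0ℚ) refl x
portion-split right x = solve 1 (λ x → x := con 0ℚ :+ x :+ con 0ℚ) refl x
portion-split free  x = solve 1 (λ x → x := con 0ℚ :+ con 0ℚ :+ x) refl x

portion-nonneg : ∀ t d {x} → 0ℚ ≤ x → 0ℚ ≤ portion t d x
portion-nonneg left  left  0≤x = 0≤x
portion-nonneg left  right _   = ≤-refl
portion-nonneg left  free  _   = ≤-refl
portion-nonneg right left  _   = ≤-refl
portion-nonneg right right 0≤x = 0≤x
portion-nonneg right free  _   = ≤-refl
portion-nonneg free  left  _   = ≤-refl
portion-nonneg free  right _   = ≤-refl
portion-nonneg free  free  0≤x = 0≤x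

record Rebalancing {n} (m : Fin n → ℚ) (d : Fin n → Destination) (p q : ℚ) : Set where
  field
    toLeft toRight  : Fin n → ℚ
    toLeft-nonneg   : ∀ c → 0ℚ ≤ toLeft c
    toRight-nonneg  : ∀ c → 0ℚ ≤ toRight c
    splits          : ∀ c → m c ≡ toLeft c + toRight c
    toLeft-total    : sumFin n toLeft ≡ p
    toRight-total   : sumFin n toRight ≡ q
    right⇒toLeft≡0  : ∀ c → d c ≡ right → toLeft c ≡ 0ℚ
    left⇒toRight≡0  : ∀ c → d c ≡ left → toRight c ≡ 0ℚ

module _ {n} (m : Fin n → ℚ) (d : Fin n → Destination) where

  mass : Destination → ℚ
  mass t = sumFin n (λ c → portion t (d c) (m c))

  mass-split : sumFin n m ≡ mass left + mass right + mass free
  mass-split = begin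
    sumFin n m                              ≡⟨ sumFin-cong n (λ c → portion-split (d c) (m c)) ⟩
    sumFin n (λ c → a c + b c + f c)        ≡⟨ sumFin-+ n (λ c → a c + b c) f ⟩
    sumFin n (λ c → a c + b c) + mass free  ≡⟨ cong (_+ mass free) (sumFin-+ n a b) ⟩
    mass left + mass right + mass free      ∎
    where
    open ≡-Reasoning
    a b f : Fin n → ℚ
    a c = portion left (d c) (m c)
    b c = portion right (d c) (m c)
    f c = portion free (d c) (m c)

  -- The free mass is shared out in proportion to the demands p − mass left and q − mass right.
  rebalance : (∀ c → 0ℚ ≤ m c) → ∀ {p q} → sumFin n m ≡ p + q →
              mass left ≤ p → mass right ≤ q → mass left + mass right < p + q →
              Rebalancing m d p q
  rebalance m≥0 {p} {q} total β≤p γ≤q β+γ<p+q = record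
    { toLeft         = share left kˡ
    ; toRight        = share right kʳ
    ; toLeft-nonneg  = share-nonneg left kˡ≥0
    ; toRight-nonneg = share-nonneg right kʳ≥0
    ; splits         = splits
    ; toLeft-total   = share-total left p
    ; toRight-total  = share-total right q
    ; right⇒toLeft≡0 = λ c d≡right → share-elsewhere left kˡ c d≡right refl refl
    ; left⇒toRight≡0 = λ c d≡left → share-elsewhere right kʳ c d≡left refl refl
    }
    where
    β γ ν : ℚ
    β = mass left
    γ = mass right
    ν = mass free

    ν≡slack : ν ≡ (p + q) - (β + γ)
    ν≡slack = begin
      ν                      ≡⟨ solve 3 (λ b g v → v := (b :+ g :+ v) :- (b :+ g)) refl β γ ν ⟩
      (β + γ + ν) - (β + γ)  ≡⟨ cong (_- (β + γ)) (trans (sym mass-split) total) ⟩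
      (p + q) - (β + γ)      ∎
      where open ≡-Reasoning

    instance
      ν-positive : Positive ν
      ν-positive = positive (subst (0ℚ <_) (sym ν≡slack) (p<q⇒0<q-p β+γ<p+q))
      ν-nonZero : NonZero ν
      ν-nonZero = pos⇒nonZero ν

    kˡ kʳ : ℚ
    kˡ = (p - β) ÷ ν
    kʳ = (q - γ) ÷ ν

    1/ν≥0 : 0ℚ ≤ 1/ ν
    1/ν≥0 = nonNegative⁻¹ (1/ ν) {{pos⇒nonNeg (1/ ν) {{1/pos⇒pos ν}}}}

    kˡ≥0 : 0ℚ ≤ kˡ
    kˡ≥0 = *-nonneg (p≤q⇒0≤q-p β≤p) 1/ν≥0

    kʳ≥0 : 0ℚ ≤ kʳ
    kʳ≥0 = *-nonneg (p≤q⇒0≤q-p γ≤q) 1/ν≥0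

    kˡ+kʳ≡1 : kˡ + kʳ ≡ 1ℚ
    kˡ+kʳ≡1 = begin
      (p - β) * 1/ ν + (q - γ) * 1/ ν  ≡⟨ *-distribʳ-+ (1/ ν) (p - β) (q - γ) ⟨
      ((p - β) + (q - γ)) * 1/ ν       ≡⟨ cong (_* 1/ ν) (trans slack (sym ν≡slack)) ⟩
      ν * 1/ ν                         ≡⟨ *-inverseʳ ν ⟩
      1ℚ                               ∎
      where
      open ≡-Reasoning
      slack : (p - β) + (q - γ) ≡ (p + q) - (β + γ)
      slack = solve 4 (λ p q b g → (p :- b) :+ (q :- g) := (p :+ q) :- (b :+ g)) refl p q β γ

    ν*÷ν : ∀ x → ν * (x ÷ ν) ≡ x
    ν*÷ν x = trans (solve 3 (λ v x i → v :* (x :* i) := x :* (v :* i)) refl ν x (1/ ν))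
                   (trans (cong (x *_) (*-inverseʳ ν)) (*-identityʳ x))

    share : Destination → ℚ → Fin n → ℚ
    share t k c = portion t (d c) (m c) + portion free (d c) (m c) * k

    share-nonneg : ∀ t {k} → 0ℚ ≤ k → ∀ c → 0ℚ ≤ share t k c
    share-nonneg t k≥0 c =
      +-mono-≤ (portion-nonneg t (d c) (m≥0 c)) (*-nonneg (portion-nonneg free (d c) (m≥0 c)) k≥0)

    share-elsewhere : ∀ t {u} k c → d c ≡ u →
                      portion t u (m c) ≡ 0ℚ → portion free u (m c) ≡ 0ℚ → share t k c ≡ 0ℚ
    share-elsewhere t k c refl a≡0 f≡0 =
      trans (cong₂ (λ a f → a + f * k) a≡0 f≡0) (trans (+-identityˡ (0ℚ * k)) (*-zeroˡ k))

    share-total : ∀ t r → sumFin n (share t ((r - mass t) ÷ ν)) ≡ r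
    share-total t r = begin
      sumFin n (share t k)             ≡⟨ sumFin-+ n (λ c → portion t (d c) (m c)) (λ c → f c * k) ⟩
      mass t + sumFin n (λ c → f c * k)  ≡⟨ cong (mass t +_) (sumFin-*ʳ n f k) ⟩
      mass t + ν * k                   ≡⟨ cong (mass t +_) (ν*÷ν (r - mass t)) ⟩
      mass t + (r - mass t)            ≡⟨ solve 2 (λ a r → a :+ (r :- a) := r) refl (mass t) r ⟩
      r                                ∎
      where
      open ≡-Reasoning
      k = (r - mass t) ÷ ν
      f = λ c → portion free (d c) (m c)

    splits : ∀ c → m c ≡ share left kˡ c + share right kʳ c
    splits c = begin
      m c                                ≡⟨ portion-split (d c) (m c) ⟩
      a + b + f                          ≡⟨ cong (a + b +_) (trans (cong (f *_) kˡ+kʳ≡1) (*-identityʳ f)) ⟨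
      a + b + f * (kˡ + kʳ)
        ≡⟨ solve 5 (λ a b f x y → a :+ b :+ f :* (x :+ y) := (a :+ f :* x) :+ (b :+ f :* y)) refl a b f kˡ kʳ ⟩
      share left kˡ c + share right kʳ c  ∎
      where
      open ≡-Reasoning
      a = portion left (d c) (m c)
      b = portion right (d c) (m c)
      f = portion free (d c) (m c)

module _ {n₁ n₂} {R : Fin n₁ → Fin n₂ → Set} {μ₁ : Dist n₁} {μ₂ : Dist n₂} where

  Lift-weight≤target : (lift : Lift R μ₁ μ₂) → ∀ s₁ s₂ → proj₁ lift s₁ s₂ ≤ prob μ₂ s₂
  Lift-weight≤target (w , w≥0 , _ , _ , cols , _) s₁ s₂ =
    subst (w s₁ s₂ ≤_) (sym (cols s₂)) (≤-sumFin n₁ (λ s → w≥0 s s₂) s₁)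

  Lift-support : Lift R μ₁ μ₂ → ∀ {s₁} → 0ℚ < prob μ₁ s₁ → ∃[ s₂ ] (0ℚ < prob μ₂ s₂ × R s₁ s₂)
  Lift-support lift@(w , _ , _ , rows , _ , supp) {s₁} 0<μ₁
    with sumFin-pos n₂ (w s₁) (subst (0ℚ <_) (rows s₁) 0<μ₁)
  ... | s₂ , 0<w = s₂ , <-≤-trans 0<w (Lift-weight≤target lift s₁ s₂) , supp s₁ s₂ 0<w

  Lift-mono-supp : ∀ {R′ : Fin n₁ → Fin n₂ → Set} →
                   (∀ s₁ s₂ → 0ℚ < prob μ₂ s₂ → R s₁ s₂ → R′ s₁ s₂) →
                   Lift R μ₁ μ₂ → Lift R′ μ₁ μ₂
  Lift-mono-supp R⇒R′ lift@(w , w≥0 , w≤1 , rows , cols , supp) =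
    w , w≥0 , w≤1 , rows , cols ,
    λ s₁ s₂ 0<w → R⇒R′ s₁ s₂ (<-≤-trans 0<w (Lift-weight≤target lift s₁ s₂)) (supp s₁ s₂ 0<w)

Enabled : (L : LPTS) → Fin (nS L) → Action → Set
Enabled L s a = Σ[ μ ∈ Dist (nS L) ] Step L s a μ

enabled? : (L : LPTS) → ∀ s a → Dec (Enabled L s a)
enabled? L s a = map′ fromAny (λ (_ , step) → lose step (refl , refl))
  (any? (λ (t , b , _) → (t Fin.≟ s) ×-dec (b ℕ.≟ a)) (LPTS.trans L))
  where
  fromAny : Any (λ (t , b , _) → t ≡ s × b ≡ a) (LPTS.trans L) → Enabled L s a
  fromAny h with find h
  ... | (_ , _ , μ) , step , refl , refl = μ , step

Deadlock : (L : LPTS) → Fin (nS L) → Set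
Deadlock L s = ∀ a μ → ¬ Step L s a μ

deadlock-reflected : ∀ {L₁ L₂ R s t} → IsStrongSimulation L₁ L₂ R → R s t →
                     Deadlock L₂ t → Deadlock L₁ s
deadlock-reflected sim sRt dead a μ step = let (_ , step₂ , _) = sim _ _ a μ sRt step in dead a _ step₂

fromTransitions : ∀ {n} → Fin n → List (Fin n × Action × Dist n) → LPTS
fromTransitions {n} s τ = record
  { nS = n ; start = s ; acts = map (proj₁ ∘ proj₂) τ ; trans = τ
  ; transOK = λ _ _ _ → ∈-map⁺ (proj₁ ∘ proj₂) }

halves₁₂ : Dist 4
halves₁₂ = record
  { prob    = λ { 0F → 0ℚ ; 1F → ½ ; 2F → ½ ; 3F → 0ℚ }
  ; nonneg  = λ { 0F → ≤-refl ; 1F → nonNegative⁻¹ ½ ; 2F → nonNegative⁻¹ ½ ; 3F → ≤-refl }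
  ; sumsOne = refl }

δ₃ : Dist 4
δ₃ = record
  { prob    = λ { 3F → 1ℚ ; _ → 0ℚ }
  ; nonneg  = λ { 0F → ≤-refl ; 1F → ≤-refl ; 2F → ≤-refl ; 3F → nonNegative⁻¹ 1ℚ }
  ; sumsOne = refl }

joined separated : LPTS
joined    = fromTransitions 0F ((0F , 0 , halves₁₂) ∷ (1F , 1 , δ₃) ∷ (1F , 2 , δ₃) ∷ [])
separated = fromTransitions 0F ((0F , 0 , halves₁₂) ∷ (1F , 1 , δ₃) ∷ (2F , 2 , δ₃) ∷ [])

joined-reactive : Reactive joined
joined-reactive _ _ _ _ (here refl)                 (here refl)                 _ = refl
joined-reactive _ _ _ _ (there (here refl))         (there (here refl))         _ = refl
joined-reactive _ _ _ _ (there (there (here refl))) (there (there (here refl))) _ = refl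
joined-reactive _ _ _ _ (here refl)                 (there (here ()))           _
joined-reactive _ _ _ _ (here refl)                 (there (there (here ())))   _
joined-reactive _ _ _ _ (there (here refl))         (there (there (here ())))   _

separated-reactive : Reactive separated
separated-reactive _ _ _ _ (here refl)                 (here refl)                 _ = refl
separated-reactive _ _ _ _ (there (here refl))         (there (here refl))         _ = refl
separated-reactive _ _ _ _ (there (there (here refl))) (there (there (here refl))) _ = refl
separated-reactive _ _ _ _ (here refl)                 (there (here ()))           _
separated-reactive _ _ _ _ (here refl)                 (there (there (here ())))   _
separated-reactive _ _ _ _ (there (here refl))         (there (there (here ())))   _

joined-deadlock₂ : Deadlock joined 2F
joined-deadlock₂ _ _ (there (there (there ())))

joined-deadlock₃ : Deadlock joined 3F
joined-deadlock₃ _ _ (there (there (there ())))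

separated-label : ∀ {s a μ} → Step separated s a μ → a ≡ toℕ s
separated-label (here refl)                 = refl
separated-label (there (here refl))         = refl
separated-label (there (there (here refl))) = refl

separated-simulation-label : ∀ L {R s t a μ} → IsStrongSimulation L separated R → R s t →
                             Step L s a μ → a ≡ toℕ t
separated-simulation-label _ sim sRt step = separated-label (proj₁ (proj₂ (sim _ _ _ _ sRt step)))

joined⋠separated : ¬ (joined ≼ separated)
joined⋠separated (R , sim , r₀) with sim 0F 0F 0 halves₁₂ r₀ (here refl)
... | _ , there (here ()) , _
... | _ , there (there (here ())) , _
... | _ , here refl , lift with Lift-support {R = R} {halves₁₂} {halves₁₂} lift {1F} (positive⁻¹ ½)
... | _ , _ , r with trans (separated-simulation-label joined sim r (there (here refl)))
                           (sym (separated-simulation-label joined sim r (there (there (here refl)))))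
... | ()

module FullyProbabilisticBelowJoined
  (C : LPTS) (fp : FullyProbabilistic C)
  (R : Fin (nS C) → Fin 4 → Set) (sim : IsStrongSimulation C joined R) where

  data Offers (c : Fin (nS C)) : Destination → Set where
    offers₁    : Enabled C c 1 → Offers c left
    offers₂    : ¬ Enabled C c 1 → Enabled C c 2 → Offers c right
    offersNone : ¬ Enabled C c 1 → ¬ Enabled C c 2 → Offers c free

  offers : ∀ c → Σ[ d ∈ Destination ] Offers c d
  offers c with enabled? C c 1 | enabled? C c 2
  ... | yes e₁ | _      = left  , offers₁ e₁
  ... | no ¬e₁ | yes e₂ = right , offers₂ ¬e₁ e₂
  ... | no ¬e₁ | no ¬e₂ = free  , offersNone ¬e₁ ¬e₂

  destination : Fin (nS C) → Destination
  destination c = proj₁ (offers c)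

  disabled₁ : ∀ {c d} → Offers c d → d ≢ left → ¬ Enabled C c 1
  disabled₁ (offers₁ _)        d≢left = ⊥-elim (d≢left refl)
  disabled₁ (offers₂ ¬e₁ _)    _      = ¬e₁
  disabled₁ (offersNone ¬e₁ _) _      = ¬e₁

  disabled₂ : ∀ {c d} → Offers c d → d ≢ right → ¬ Enabled C c 2
  disabled₂ (offers₁ (μ , step₁)) _ (ν , step₂) with proj₁ (fp _ 1 2 μ ν step₁ step₂)
  ... | ()
  disabled₂ (offers₂ _ _)      d≢right = ⊥-elim (d≢right refl)
  disabled₂ (offersNone _ ¬e₂) _       = ¬e₂

  deadlock₂ : ∀ {c} → R c 2F → Deadlock C c
  deadlock₂ r = deadlock-reflected {C} {joined} sim r joined-deadlock₂

  deadlock₃ : ∀ {c} → R c 3F → Deadlock C c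
  deadlock₃ r = deadlock-reflected {C} {joined} sim r joined-deadlock₃

  -- A state below s₁ or s₂ of `joined` goes to the state of `separated` offering its action.
  Sim : Fin (nS C) → Fin 4 → Set
  Sim c 0F = R c 0F
  Sim c 1F = (R c 1F ⊎ R c 2F) × ¬ Enabled C c 2
  Sim c 2F = (R c 1F ⊎ R c 2F) × ¬ Enabled C c 1
  Sim c 3F = R c 3F

  onto-δ₃ : ∀ μ → Lift R μ δ₃ → Lift Sim μ δ₃
  onto-δ₃ μ = Lift-mono-supp {R = R} {μ} {δ₃} inSupport
    where
    inSupport : ∀ c t → 0ℚ < prob δ₃ t → R c t → Sim c t
    inSupport c 3F _   r = r
    inSupport c 0F 0<0 _ = ⊥-elim (<-irrefl refl 0<0)
    inSupport c 1F 0<0 _ = ⊥-elim (<-irrefl refl 0<0)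
    inSupport c 2F 0<0 _ = ⊥-elim (<-irrefl refl 0<0)

  onto-halves₁₂ : ∀ μ → Lift R μ halves₁₂ → Lift Sim μ halves₁₂
  onto-halves₁₂ μ lift@(w , w≥0 , _ , rows , cols , supp) =
    w′ , w′≥0 , w′≤1 , rows′ , cols′ , supp′
    where
    n = nS C
    m = prob μ

    enabled⇒weight₁ : ∀ {c a} → Enabled C c a → m c ≡ w c 1F
    enabled⇒weight₁ {c} (ν , step) = begin
      m c                                           ≡⟨ rows c ⟩
      w c 0F + (w c 1F + (w c 2F + (w c 3F + 0ℚ)))
        ≡⟨ cong₂ (λ x y → x + (w c 1F + y))
                 (null 0F refl) (cong₂ _+_ w₂≡0 (cong (_+ 0ℚ) (null 3F refl))) ⟩
      0ℚ + (w c 1F + (0ℚ + (0ℚ + 0ℚ)))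
        ≡⟨ solve 1 (λ x → con 0ℚ :+ (x :+ (con 0ℚ :+ (con 0ℚ :+ con 0ℚ))) := x) refl (w c 1F) ⟩
      w c 1F                                        ∎
      where
      open ≡-Reasoning
      null : ∀ t → prob halves₁₂ t ≡ 0ℚ → w c t ≡ 0ℚ
      null t p≡0 =
        ≤-antisym (subst (w c t ≤_) p≡0 (Lift-weight≤target {R = R} {μ} {halves₁₂} lift c t)) (w≥0 c t)
      w₂≡0 : w c 2F ≡ 0ℚ
      w₂≡0 = ≤-antisym (≮⇒≥ (λ 0<w → deadlock₂ (supp c 2F 0<w) _ ν step)) (w≥0 c 2F)

    pinned≤weight₁ : ∀ {c d} → Offers c d → portion left d (m c) + portion right d (m c) ≤ w c 1F
    pinned≤weight₁ {c} (offers₁ e)      = ≤-reflexive (trans (+-identityʳ (m c)) (enabled⇒weight₁ e))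
    pinned≤weight₁ {c} (offers₂ _ e)    = ≤-reflexive (trans (+-identityˡ (m c)) (enabled⇒weight₁ e))
    pinned≤weight₁ {c} (offersNone _ _) = w≥0 c 1F

    β≤ : mass m destination left ≤ mass m destination left + mass m destination right
    β≤ = p≤p+q (sumFin-nonneg n (λ c → portion-nonneg right (destination c) (nonneg μ c)))

    γ≤ : mass m destination right ≤ mass m destination left + mass m destination right
    γ≤ = q≤p+q (sumFin-nonneg n (λ c → portion-nonneg left (destination c) (nonneg μ c)))

    pinned≤½ : mass m destination left + mass m destination right ≤ ½
    pinned≤½ = begin
      mass m destination left + mass m destination right  ≡⟨ sumFin-+ n _ _ ⟨
      sumFin n (λ c → portion left (destination c) (m c) + portion right (destination c) (m c))
        ≤⟨ sumFin-mono n (λ c → pinned≤weight₁ (proj₂ (offers c))) ⟩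
      sumFin n (λ c → w c 1F)                             ≡⟨ cols 1F ⟨
      ½                                                   ∎
      where open ≤-Reasoning

    ½<½+½ : ½ < ½ + ½
    ½<½+½ = subst (_< ½ + ½) (+-identityʳ ½) (+-monoʳ-< ½ (positive⁻¹ ½))

    open Rebalancing (rebalance m destination (nonneg μ) (sumsOne μ)
      (≤-trans β≤ pinned≤½) (≤-trans γ≤ pinned≤½) (≤-<-trans pinned≤½ ½<½+½))

    w′ : Fin n → Fin 4 → ℚ
    w′ c 0F = 0ℚ
    w′ c 1F = toLeft c
    w′ c 2F = toRight c
    w′ c 3F = 0ℚ

    toLeft≤m : ∀ c → toLeft c ≤ m c
    toLeft≤m c = subst (toLeft c ≤_) (sym (splits c)) (p≤p+q (toRight-nonneg c))

    toRight≤m : ∀ c → toRight c ≤ m c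
    toRight≤m c = subst (toRight c ≤_) (sym (splits c)) (q≤p+q (toLeft-nonneg c))

    m≤1 : ∀ c → m c ≤ 1ℚ
    m≤1 c = subst (m c ≤_) (sumsOne μ) (≤-sumFin n (nonneg μ) c)

    w′≥0 : ∀ c t → 0ℚ ≤ w′ c t
    w′≥0 c 0F = ≤-refl
    w′≥0 c 1F = toLeft-nonneg c
    w′≥0 c 2F = toRight-nonneg c
    w′≥0 c 3F = ≤-refl

    w′≤1 : ∀ c t → w′ c t ≤ 1ℚ
    w′≤1 c 0F = nonNegative⁻¹ 1ℚ
    w′≤1 c 1F = ≤-trans (toLeft≤m c) (m≤1 c)
    w′≤1 c 2F = ≤-trans (toRight≤m c) (m≤1 c)
    w′≤1 c 3F = nonNegative⁻¹ 1ℚ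

    rows′ : ∀ c → m c ≡ sumFin 4 (w′ c)
    rows′ c = trans (splits c)
      (solve 2 (λ l r → l :+ r := con 0ℚ :+ (l :+ (r :+ (con 0ℚ :+ con 0ℚ)))) refl (toLeft c) (toRight c))

    cols′ : ∀ t → prob halves₁₂ t ≡ sumFin n (λ c → w′ c t)
    cols′ 0F = sym (sumFin-zero n)
    cols′ 1F = sym toLeft-total
    cols′ 2F = sym toRight-total
    cols′ 3F = sym (sumFin-zero n)

    related : ∀ {c} → 0ℚ < m c → R c 1F ⊎ R c 2F
    related 0<m with Lift-support {R = R} {μ} {halves₁₂} lift 0<m
    ... | 0F , 0<0 , _ = ⊥-elim (<-irrefl refl 0<0)
    ... | 1F , _   , r = inj₁ r
    ... | 2F , _   , r = inj₂ r
    ... | 3F , 0<0 , _ = ⊥-elim (<-irrefl refl 0<0)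

    supp′ : ∀ c t → 0ℚ < w′ c t → Sim c t
    supp′ c 0F 0<0 = ⊥-elim (<-irrefl refl 0<0)
    supp′ c 1F 0<l = related (<-≤-trans 0<l (toLeft≤m c)) ,
      disabled₂ (proj₂ (offers c)) (λ d≡right → <-irrefl (sym (right⇒toLeft≡0 c d≡right)) 0<l)
    supp′ c 2F 0<r = related (<-≤-trans 0<r (toRight≤m c)) ,
      disabled₁ (proj₂ (offers c)) (λ d≡left → <-irrefl (sym (left⇒toRight≡0 c d≡left)) 0<r)
    supp′ c 3F 0<0 = ⊥-elim (<-irrefl refl 0<0)

  simulation : IsStrongSimulation C separated Sim
  simulation c 0F a μ r step with sim c 0F a μ r step
  ... | _ , here refl , lift                 = halves₁₂ , here refl , onto-halves₁₂ μ lift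
  ... | _ , there (here ()) , _
  ... | _ , there (there (here ())) , _
  simulation c 1F a μ (inj₁ r , ¬e₂) step with sim c 1F a μ r step
  ... | _ , there (here refl) , lift         = δ₃ , there (here refl) , onto-δ₃ μ lift
  ... | _ , there (there (here refl)) , _    = ⊥-elim (¬e₂ (μ , step))
  simulation c 1F a μ (inj₂ r , _) step      = ⊥-elim (deadlock₂ r a μ step)
  simulation c 2F a μ (inj₁ r , ¬e₁) step with sim c 1F a μ r step
  ... | _ , there (here refl) , _            = ⊥-elim (¬e₁ (μ , step))
  ... | _ , there (there (here refl)) , lift = δ₃ , there (there (here refl)) , onto-δ₃ μ lift
  simulation c 2F a μ (inj₂ r , _) step      = ⊥-elim (deadlock₂ r a μ step)
  simulation c 3F a μ r step                 = ⊥-elim (deadlock₃ r a μ step)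

fullyProbabilistic-≼joined⇒≼separated : ∀ C → FullyProbabilistic C → C ≼ joined → C ≼ separated
fullyProbabilistic-≼joined⇒≼separated C fp (R , sim , r₀) = Sim , simulation , r₀
  where open FullyProbabilisticBelowJoined C fp R sim

lemma4 : Σ[ R₁ ∈ LPTS ] Σ[ R₂ ∈ LPTS ]
           (Reactive R₁ × Reactive R₂ × ¬ (R₁ ≼ R₂) ×
            ¬ (Σ[ C ∈ LPTS ] (FullyProbabilistic C × (C ≼ R₁) × ¬ (C ≼ R₂))))
lemma4 = joined , separated , joined-reactive , separated-reactive , joined⋠separated ,
  λ (C , fp , C≼joined , C⋠separated) → C⋠separated (fullyProbabilistic-≼joined⇒≼separated C fp C≼joined)
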